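{- Let $k\geq 2$ be an integer and let $(u(n))_{n\geq 0}$ be a $k$-automatic sequence. Then the set of sequences $$\{(u([1^n 0^j]_k))_{n\geq 1}\;:\; j\in \mathbb{N} \}$$ is finite.
   Context: For a word $w$ over the alphabet $\{0,\dots,k-1\}$, $[w]_k$ denotes the integer whose base-$k$ expansion is $w$; for a letter $x$, $x^m$ denotes the word consisting of $m$ copies of $x$. Thus $[1^n0^j]_k$ is the integer whose base-$k$ expansion is $n$ ones followed by $j$ zeros. A sequence is $k$-automatic if it is generated by a deterministic finite automaton with output reading the base-$k$ expansion of $n$ (here, starting from the least significant digit). $\mathbb{N}$ includes $0$. -}

module Defs where

open import Data.Nat using (ℕ; zero; suc; _+_; _*_; _^_; _≤_; _<_; NonZero)
open import Data.Nat.DivMod using (_/_; _%_; m%n<n)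
open import Data.Fin using (Fin; fromℕ<)
open import Data.List using (List; []; _∷_; foldl)
open import Data.Product using (Σ; ∃; _×_; _,_)
open import Relation.Binary.PropositionalEquality using (_≡_)

-- Base-k expansion of n, least significant digit first, without
-- leading zeros (so 0 is the empty word).  The first argument is fuel;
-- fuel n suffices since n has at most n digits (k ≥ 2).
lsdDigitsFuel : (k : ℕ) → .{{_ : NonZero k}} → ℕ → ℕ → List (Fin k)
lsdDigitsFuel k zero    n       = []
lsdDigitsFuel k (suc f) zero    = []
lsdDigitsFuel k (suc f) (suc n) =
  fromℕ< (m%n<n (suc n) k) ∷ lsdDigitsFuel k f (suc n / k)

lsdDigits : (k : ℕ) → .{{_ : NonZero k}} → ℕ → List (Fin k)
lsdDigits k n = lsdDigitsFuel k n n

record DFAO (k : ℕ) (O : Set) : Set where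
  field
    s      : ℕ
    init   : Fin s
    δ      : Fin s → Fin k → Fin s
    τ      : Fin s → O

open DFAO public

run : ∀ {k O} (M : DFAO k O) → List (Fin k) → Fin (s M)
run M w = foldl (δ M) (init M) w

dfaoOutput : ∀ {k O} .{{_ : NonZero k}} → DFAO k O → ℕ → O
dfaoOutput {k} M n = τ M (run M (lsdDigits k n))

IsAutomatic : (k : ℕ) .{{_ : NonZero k}} {O : Set} → (ℕ → O) → Set
IsAutomatic k {O} u = Σ (DFAO k O) λ M → ∀ n → u n ≡ dfaoOutput M n

repunit : ℕ → ℕ → ℕ
repunit k zero    = 0
repunit k (suc n) = 1 + k * repunit k n

ones-zeros : ℕ → ℕ → ℕ → ℕ
ones-zeros k n j = repunit k n * k ^ j

FinitelyManySeqs : {O : Set} → (ℕ → ℕ → O) → Set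
FinitelyManySeqs {O} F =
  Σ ℕ λ m → Σ (Fin m → ℕ → O) λ g →
    ∀ j → Σ (Fin m) λ i → ∀ n → 1 ≤ n → F j n ≡ g i n

module Submission where

-- For n ≥ 1 the least-significant-digit-first base-k
-- expansion of [1^n 0^j]_k is the word 0^j 1^n.  A DFAO reading this word
-- first consumes 0^j, reaching some state q_j, and then consumes 1^n.  Hence
-- the j-th sequence n ↦ u([1^n 0^j]_k) is determined by the state q_j alone:
-- it equals n ↦ τ(δ*(q_j, 1^n)).  Since there are only finitely many states,
-- the sequences (one per state) form the required finite list.

open import Defs
open import Data.Nat.Base
open import Data.Nat.Properties
open import Data.Nat.DivMod
open import Data.Nat.Divisibility using (divides-refl)
open import Data.Fin using (Fin; fromℕ<)
open import Data.Fin.Properties using (fromℕ<-cong)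
open import Data.List using (List; _∷_; foldl; replicate; _++_)
open import Data.List.Properties using (foldl-++)
open import Data.Product using (Σ; _,_)
open import Function using (_∘_)
open import Relation.Binary.PropositionalEquality
open ≡-Reasoning

module BaseExpansion (k : ℕ) .{{_ : NonZero k}} (1<k : 1 < k) where

  -- Any fuel at least n computes the full expansion of n; needed because
  -- lsdDigits k n uses fuel n, whereas its tail is computed with fuel n - 1.
  fuel-irrelevant : ∀ f f' n → n ≤ f → n ≤ f' →
                    lsdDigitsFuel k f n ≡ lsdDigitsFuel k f' n
  fuel-irrelevant zero    zero     zero    _ _ = refl
  fuel-irrelevant zero    (suc f') zero    _ _ = refl
  fuel-irrelevant (suc f) zero     zero    _ _ = refl
  fuel-irrelevant (suc f) (suc f') zero    _ _ = refl
  fuel-irrelevant (suc f) (suc f') (suc n) n≤f n≤f' =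
    cong (_ ∷_) (fuel-irrelevant f f' (suc n / k) (quotient-fits n≤f) (quotient-fits n≤f'))
    where
    quotient-fits : ∀ {g} → suc n ≤ suc g → suc n / k ≤ g
    quotient-fits le = s≤s⁻¹ (<-≤-trans (m/n<m (suc n) k 1<k) le)

  digits-cons : ∀ x d y (d<k : d < k) → x ≡ d + y * k → 0 < x →
                lsdDigits k x ≡ fromℕ< d<k ∷ lsdDigits k y
  digits-cons (suc m) d y d<k x≡ _ = cong₂ _∷_ lowest-digit rest
    where
    remainder : suc m % k ≡ d
    remainder = begin
      suc m % k       ≡⟨ cong (_% k) x≡ ⟩
      (d + y * k) % k ≡⟨ [m+kn]%n≡m%n d y k ⟩
      d % k           ≡⟨ m<n⇒m%n≡m d<k ⟩
      d               ∎

    quotient : suc m / k ≡ y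
    quotient = begin
      suc m / k           ≡⟨ cong (_/ k) x≡ ⟩
      (d + y * k) / k     ≡⟨ +-distrib-/-∣ʳ d (divides-refl y) ⟩
      d / k + y * k / k   ≡⟨ cong₂ _+_ (m<n⇒m/n≡0 d<k) (m*n/n≡m y k) ⟩
      y                   ∎

    lowest-digit : fromℕ< (m%n<n (suc m) k) ≡ fromℕ< d<k
    lowest-digit = fromℕ<-cong _ _ remainder (m%n<n (suc m) k) d<k

    y≤m : y ≤ m
    y≤m = s≤s⁻¹ (subst (_< suc m) quotient (m/n<m (suc m) k 1<k))

    rest : lsdDigitsFuel k m (suc m / k) ≡ lsdDigits k y
    rest = trans (cong (lsdDigitsFuel k m) quotient) (fuel-irrelevant m y y y≤m ≤-refl)

  0<k : 0 < k
  0<k = <-trans z<s 1<k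

  zero-digit : Fin k
  zero-digit = fromℕ< 0<k

  one-digit : Fin k
  one-digit = fromℕ< 1<k

  repunit-digits : ∀ n → lsdDigits k (repunit k n) ≡ replicate n one-digit
  repunit-digits zero    = refl
  repunit-digits (suc n) = begin
    lsdDigits k (repunit k (suc n))          ≡⟨ digits-cons _ 1 (repunit k n) 1<k
                                                  (cong suc (*-comm k (repunit k n))) z<s ⟩
    one-digit ∷ lsdDigits k (repunit k n)   ≡⟨ cong (one-digit ∷_) (repunit-digits n) ⟩
    replicate (suc n) one-digit              ∎

  shift-digits : ∀ x j → 0 < x →
                 lsdDigits k (x * k ^ j) ≡ replicate j zero-digit ++ lsdDigits k x
  shift-digits x zero    _   = cong (lsdDigits k) (*-identityʳ x)
  shift-digits x (suc j) 0<x = begin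
    lsdDigits k (x * k ^ suc j)              ≡⟨ digits-cons _ 0 (x * k ^ j) 0<k shift 0<x*k^suc-j ⟩
    zero-digit ∷ lsdDigits k (x * k ^ j)     ≡⟨ cong (zero-digit ∷_) (shift-digits x j 0<x) ⟩
    replicate (suc j) zero-digit ++ lsdDigits k x ∎
    where
    shift : x * (k * k ^ j) ≡ 0 + x * k ^ j * k
    shift = trans (cong (x *_) (*-comm k (k ^ j))) (sym (*-assoc x (k ^ j) k))

    0<x*k^suc-j : 0 < x * k ^ suc j
    0<x*k^suc-j = <-≤-trans 0<x (m≤m*n x (k ^ suc j) {{m^n≢0 k (suc j)}})

  ones-zeros-digits : ∀ n j → 1 ≤ n →
    lsdDigits k (ones-zeros k n j) ≡ replicate j zero-digit ++ replicate n one-digit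
  ones-zeros-digits (suc n) j _ = begin
    lsdDigits k (repunit k (suc n) * k ^ j)                      ≡⟨ shift-digits _ j z<s ⟩
    replicate j zero-digit ++ lsdDigits k (repunit k (suc n))    ≡⟨ cong (replicate j zero-digit ++_)
                                                                       (repunit-digits (suc n)) ⟩
    replicate j zero-digit ++ replicate (suc n) one-digit        ∎

outputFrom : ∀ {k O} (M : DFAO k O) → Fin (s M) → List (Fin k) → O
outputFrom M q w = τ M (foldl (δ M) q w)

output-++ : ∀ {k O} (M : DFAO k O) (v w : List (Fin k)) →
            τ M (run M (v ++ w)) ≡ outputFrom M (run M v) w
output-++ M v w = cong (τ M) (foldl-++ (δ M) (init M) v w)

lemma1 : (k : ℕ) → .{{_ : NonZero k}} → 2 ≤ k → {O : Set} → (u : ℕ → O) →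
         IsAutomatic k u →
         FinitelyManySeqs (λ j n → u (ones-zeros k n j))
lemma1 k 2≤k {O} u (M , u≡M) = s M , sequenceFrom , λ j → run M (zeros j) , agrees j
  where
  open BaseExpansion k 2≤k

  zeros : ℕ → List (Fin k)
  zeros j = replicate j zero-digit

  sequenceFrom : Fin (s M) → ℕ → O
  sequenceFrom q n = outputFrom M q (replicate n one-digit)

  agrees : ∀ j n → 1 ≤ n → u (ones-zeros k n j) ≡ sequenceFrom (run M (zeros j)) n
  agrees j n 1≤n = begin
    u (ones-zeros k n j)                                 ≡⟨ u≡M _ ⟩
    τ M (run M (lsdDigits k (ones-zeros k n j)))          ≡⟨ cong (τ M ∘ run M) (ones-zeros-digits n j 1≤n) ⟩
    τ M (run M (zeros j ++ replicate n one-digit))        ≡⟨ output-++ M (zeros j) _ ⟩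
    sequenceFrom (run M (zeros j)) n                      ∎
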